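{- Let $G$ be a finite simple undirected graph containing no $3$-cycles and no $4$-cycles. Then $\mathcal{H}^{\mathrm{Path}}_n(G)\cong(0)$ for all $n\ge2$.
   Context: $R$ is a commutative ring with unit. Path homology: for $V=V(G)$, $\mathcal{C}_n(V)$ is the free $R$-module on $(n+1)$-tuples $(v_0,\dots,v_n)$ of vertices modulo the span of tuples with $v_i=v_{i+1}$ for some $i$, with $\partial_n(v_0,\dots,v_n)=\sum_{i=0}^n(-1)^i(v_0,\dots,\widehat{v_i},\dots,v_n)$ for $n\ge1$ and $\partial_0=0$. An allowed path is a tuple with $\{v_i,v_{i+1}\}\in E(G)$ for all $i<n$; $\widetilde{\mathcal{C}}_n(G)\subseteq\mathcal{C}_n(V)$ is the submodule generated by allowed paths, $\widetilde{\mathcal{C}}_{ -1}=0$; $\mathcal{C}^{\mathrm{Path}}_n(G)=\{x\in\widetilde{\mathcal{C}}_n(G):\partial_nx\in\widetilde{\mathcal{C}}_{n-1}(G)\}$, which forms a chain complex, and $\mathcal{H}^{\mathrm{Path}}_n(G)=\ker\partial_n/\mathrm{Im}\,\partial_{n+1}$. -}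

module Defs where

open import Level using (Level)
open import Data.Nat using (ℕ; zero; suc)
open import Data.Fin using (Fin; toℕ)
open import Data.Fin.Properties using (_≟_)
open import Data.Bool using (Bool; true; false; not; _∧_; if_then_else_; T)
open import Data.Vec using (Vec; []; _∷_; insertAt)
open import Data.Product using (Σ; _×_; _,_)
open import Relation.Nullary using (¬_; does)
open import Relation.Binary.PropositionalEquality using (_≡_)
open import Algebra.Bundles using (CommutativeRing)
import Algebra.Properties.Monoid.Sum as MonoidSum

record Graph : Set where
  field
    k     : ℕ
    E     : Fin k → Fin k → Bool
    E-sym : ∀ u v → E u v ≡ E v u
    E-irr : ∀ v → E v v ≡ false

No3Cycle : Graph → Set
No3Cycle G = ∀ a b c → ¬ (a ≢ b × b ≢ c × a ≢ c ×
                           T (E a b) × T (E b c) × T (E c a))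
  where open Graph G
        _≢_ : Fin k → Fin k → Set
        x ≢ y = ¬ (x ≡ y)

No4Cycle : Graph → Set
No4Cycle G = ∀ a b c d → ¬ ((a ≢ b × a ≢ c × a ≢ d × b ≢ c × b ≢ d × c ≢ d) ×
                             T (E a b) × T (E b c) × T (E c d) × T (E d a))
  where open Graph G
        _≢_ : Fin k → Fin k → Set
        x ≢ y = ¬ (x ≡ y)

module PathHomology {c ℓ : Level} (R : CommutativeRing c ℓ) (G : Graph) where
  open CommutativeRing R
  open Graph G
  open MonoidSum +-monoid using (sum)

  -- (n+1)-tuples of vertices: the generators in degree n
  Tuple : ℕ → Set
  Tuple n = Vec (Fin k) (suc n)

  nondeg : ∀ {m} → Vec (Fin k) m → Bool
  nondeg []           = true
  nondeg (x ∷ [])     = true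
  nondeg (x ∷ y ∷ xs) = not (does (x ≟ y)) ∧ nondeg (y ∷ xs)

  allowed : ∀ {m} → Vec (Fin k) m → Bool
  allowed []           = true
  allowed (x ∷ [])     = true
  allowed (x ∷ y ∷ xs) = E x y ∧ allowed (y ∷ xs)

  -- An element of C_n(V): the free R-module on (n+1)-tuples modulo the
  -- span of degenerate tuples.  Since V is finite, an element is given by
  -- its coefficient function; coefficients on degenerate tuples are
  -- irrelevant (they are killed by the quotient), see _≈C_.
  Chain : ℕ → Set c
  Chain n = Tuple n → Carrier

  _≈C_ : ∀ {n} → Chain n → Chain n → Set ℓ
  _≈C_ {n} x y = ∀ (w : Tuple n) → T (nondeg w) → x w ≈ y w

  zeroC : ∀ {n} → Chain n
  zeroC _ = 0#

  sign : ℕ → Carrier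
  sign zero    = 1#
  sign (suc i) = - sign i

  -- The coefficient of a tuple w
  -- in ∂ x is the sum over all i and all non-degenerate u with
  -- (u with its i-th entry deleted) = w of (-1)^i x(u); such u are exactly
  -- insertAt w i v for v ∈ V.
  ∂ : ∀ {n} → Chain (suc n) → Chain n
  ∂ {n} x w = sum (λ (i : Fin (suc (suc n))) → sign (toℕ i) *
                sum (λ (v : Fin k) →
                  if nondeg (insertAt w i v) then x (insertAt w i v) else 0#))

  -- membership in the submodule of C_n(V) generated by allowed paths
  InAllowed : ∀ {n} → Chain n → Set ℓ
  InAllowed {n} x = ∀ (w : Tuple n) → T (nondeg w) → ¬ T (allowed w) → x w ≈ 0#

  -- membership in C^Path_n(G)  (for degrees n ≥ 1)
  InPath : ∀ n → Chain (suc n) → Set ℓ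
  InPath n x = InAllowed x × InAllowed (∂ x)

  -- H^Path_{n+1}(G) ≅ 0 : every cycle of C^Path_{n+1}(G) is the boundary
  -- of an element of C^Path_{n+2}(G)
  HomologyVanishes : ℕ → Set (Level._⊔_ c ℓ)
  HomologyVanishes n =
    ∀ (x : Chain (suc n)) → InPath n x → ∂ x ≈C zeroC →
      Σ (Chain (suc (suc n))) (λ y → InPath (suc n) y × (∂ y ≈C x))

module Submission where

-- Every x in C^Path_n(G), n ≥ 2, vanishes on non-alternating tuples. Indeed, if an allowed tuple
-- … a v b … first fails to alternate at a ≠ b, then a and b are not adjacent (no 3-cycle) and v is
-- their only common neighbour (no 4-cycle). Deleting v gives a face that is not allowed, so its
-- coefficient in ∂x vanishes; but every way of inserting a vertex into that face, other than
-- putting v back, yields a tuple that is not allowed, so this coefficient is ± x at the tuple.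
-- Only prepending or appending a vertex keeps a tuple alternating, so at an alternating tuple
-- a b a … the cycle condition reads x(b a b …) ± x(a b a …) = 0, and the boundary of the chain
-- y(u ∷ w) = x(w), for alternating u ∷ w with head w < u, is x.

open import Defs
open import Level using (Level)
open import Data.Nat using (ℕ; suc; _≤_)
open import Algebra.Bundles using (CommutativeRing)

open import Algebra.Bundles using (CommutativeMonoid; AbelianGroup)
open import Data.Nat using (zero; s≤s; z≤n)
open import Data.Fin using (Fin; toℕ; punchIn; _<_)
open import Data.Fin.Properties using (_≟_; _<?_; <-cmp; <-asym; punchInᵢ≢i)
open import Data.Bool using (Bool; true; false; _∧_; if_then_else_; T; T?)
open import Data.Bool.Properties using (T-≡; T-∧; ∧-zeroʳ; ∧-idem; ∧-identityʳ)
open import Data.Vec using (Vec; []; _∷_; _∷ʳ_; insertAt; head; tail)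
open import Data.Product using (Σ; _×_; _,_; proj₁; proj₂)
open import Function using (_∘_; Equivalence)
open import Relation.Nullary using (¬_; Dec; does; yes; no; contradiction)
open import Relation.Nullary.Decidable using (dec-true; dec-false)
open import Relation.Binary.Definitions using (tri<; tri≈; tri>)
open import Relation.Binary.PropositionalEquality as ≡ using (_≡_; _≢_; refl; ≢-sym)
import Algebra.Properties.CommutativeMonoid.Sum as CommutativeMonoidSum
import Algebra.Properties.AbelianGroup as AbelianGroupProperties
import Algebra.Properties.Ring as RingProperties

module CommutativeMonoidSumProperties {a ℓ} (M : CommutativeMonoid a ℓ) where
  open CommutativeMonoid M renaming (ε to 0#; _∙_ to _+_)
  open CommutativeMonoidSum M using (sum; sum-cong-≋; sum-replicate-zero; sum-remove)

  sum-zero : ∀ {m} {f : Fin m → Carrier} → (∀ i → f i ≈ 0#) → sum f ≈ 0#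
  sum-zero {m} f≈0 = trans (sum-cong-≋ f≈0) (sum-replicate-zero m)

  sum-single : ∀ {m} {f : Fin m → Carrier} j → (∀ i → i ≢ j → f i ≈ 0#) → sum f ≈ f j
  sum-single {suc _} {f} j f≈0 = trans (sum-remove {i = j} f) (trans
    (∙-congˡ (sum-zero (λ i → f≈0 (punchIn j i) (punchInᵢ≢i j i))))
    (identityʳ (f j)))

module AbelianGroupSumProperties {a ℓ} (G : AbelianGroup a ℓ) where
  open AbelianGroup G
  open AbelianGroupProperties G using (ε⁻¹≈ε; ⁻¹-∙-comm)
  open CommutativeMonoidSum commutativeMonoid using (sum)

  sum-⁻¹ : ∀ {m} (f : Fin m → Carrier) → sum (λ i → f i ⁻¹) ≈ sum f ⁻¹
  sum-⁻¹ {zero}  f = sym ε⁻¹≈ε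
  sum-⁻¹ {suc m} f = trans (∙-congˡ (sum-⁻¹ (f ∘ Fin.suc))) (⁻¹-∙-comm _ _)

module GraphProperties (G : Graph) where
  open Graph G

  edge⇒≢ : ∀ {u v} → T (E u v) → u ≢ v
  edge⇒≢ {u} e refl = ≡.subst T (E-irr u) e

  no-triangle : No3Cycle G → ∀ {a c d} → T (E a c) → T (E c d) → a ≢ d → ¬ T (E a d)
  no-triangle no3 {a} {c} {d} ac cd a≢d ad =
    no3 a c d (edge⇒≢ ac , edge⇒≢ cd , a≢d , ac , cd , ≡.subst T (E-sym a d) ad)

  unique-common-neighbour : No4Cycle G → ∀ {a m b} → a ≢ b → T (E a m) → T (E m b) →
                            ∀ v → T (E a v) → T (E v b) → v ≡ m
  unique-common-neighbour no4 {a} {m} {b} a≢b am mb v av vb with v ≟ m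
  ... | yes v≡m = v≡m
  ... | no  v≢m = contradiction
    ((edge⇒≢ am , a≢b , edge⇒≢ av , edge⇒≢ mb , ≢-sym v≢m , edge⇒≢ vb ∘ ≡.sym) ,
     am , mb , ≡.subst T (E-sym v b) vb , ≡.subst T (E-sym a v) av)
    (no4 a m b v)

  isAlternating : ∀ {m} → Vec (Fin k) m → Bool
  isAlternating (x ∷ y ∷ z ∷ r) = does (x ≟ z) ∧ isAlternating (y ∷ z ∷ r)
  isAlternating _               = true

  alternating : Fin k → Fin k → (L : ℕ) → Vec (Fin k) L
  alternating a b zero    = []
  alternating a b (suc L) = a ∷ alternating b a L

  secondLast : ∀ {L} → Fin k → Fin k → Vec (Fin k) L → Fin k
  secondLast a b []      = a
  secondLast a b (c ∷ w) = secondLast b c w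

  isAlternating-alternating : ∀ a b L → isAlternating (alternating a b L) ≡ true
  isAlternating-alternating a b zero                = refl
  isAlternating-alternating a b (suc zero)          = refl
  isAlternating-alternating a b (suc (suc zero))    = refl
  isAlternating-alternating a b (suc (suc (suc L))) =
    ≡.cong₂ _∧_ (dec-true (a ≟ a) refl) (isAlternating-alternating b a (suc (suc L)))

  isAlternating⇒alternating : ∀ {L} a b (r : Vec (Fin k) L) → isAlternating (a ∷ b ∷ r) ≡ true →
                              a ∷ b ∷ r ≡ alternating a b (suc (suc L))
  isAlternating⇒alternating a b []      _   = refl
  isAlternating⇒alternating a b (c ∷ r) alt with a ≟ c
  ... | yes refl = ≡.cong (a ∷_) (isAlternating⇒alternating b a r alt)

  alternating-∷ʳ : ∀ a b L →
                   alternating a b L ∷ʳ secondLast a b (alternating a b L) ≡ alternating a b (suc L)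
  alternating-∷ʳ a b zero    = refl
  alternating-∷ʳ a b (suc L) = ≡.cong (a ∷_) (alternating-∷ʳ b a L)

  isAlternating-≢ : ∀ {L} {x z} y (r : Vec (Fin k) L) → x ≢ z → isAlternating (x ∷ y ∷ z ∷ r) ≡ false
  isAlternating-≢ {x = x} {z} y r x≢z rewrite dec-false (x ≟ z) x≢z = refl

  isAlternating-∷ : ∀ {m} x (u : Vec (Fin k) m) → isAlternating u ≡ false → isAlternating (x ∷ u) ≡ false
  isAlternating-∷ x []              ()
  isAlternating-∷ x (_ ∷ [])        ()
  isAlternating-∷ x (_ ∷ _ ∷ [])    ()
  isAlternating-∷ x (y ∷ z ∷ _ ∷ _) u≢ = ≡.trans (≡.cong (does (x ≟ z) ∧_) u≢) (∧-zeroʳ _)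

  isAlternating-∷ʳ : ∀ {m} (u : Vec (Fin k) m) e →
                     isAlternating u ≡ false → isAlternating (u ∷ʳ e) ≡ false
  isAlternating-∷ʳ []           e ()
  isAlternating-∷ʳ (_ ∷ [])     e ()
  isAlternating-∷ʳ (_ ∷ _ ∷ []) e ()
  isAlternating-∷ʳ (x ∷ y ∷ z ∷ r) e = ∧-falseʳ-mono (does (x ≟ z)) (isAlternating-∷ʳ (y ∷ z ∷ r) e)
    where ∧-falseʳ-mono : ∀ d {p q} → (p ≡ false → q ≡ false) → d ∧ p ≡ false → d ∧ q ≡ false
          ∧-falseʳ-mono false _   _  = refl
          ∧-falseʳ-mono true  p⇒q d∧p = p⇒q d∧p

  data Bridged : ∀ {L} → Vec (Fin k) (suc L) → Vec (Fin k) (suc (suc L)) → Set where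
    here  : ∀ {L a m b} {r : Vec (Fin k) L} → ¬ T (E a b) → (∀ v → T (E a v) → T (E v b) → v ≡ m) →
            Bridged (a ∷ b ∷ r) (a ∷ m ∷ b ∷ r)
    there : ∀ {L} a {w : Vec (Fin k) (suc L)} {f} → Bridged w f → Bridged (a ∷ w) (a ∷ f)

module AllowedTuples {c ℓ : Level} (R : CommutativeRing c ℓ) (G : Graph) where
  open Graph G
  open GraphProperties G
  open PathHomology R G using (nondeg; allowed)
  open ≡.≡-Reasoning

  nondeg-∷⁻ : ∀ {L} a b (w : Vec (Fin k) L) → T (nondeg (a ∷ b ∷ w)) → a ≢ b × T (nondeg (b ∷ w))
  nondeg-∷⁻ a b w nd with a ≟ b
  ... | no a≢b = a≢b , nd

  nondeg-∷ : ∀ {L a b} (w : Vec (Fin k) L) → a ≢ b → T (nondeg (b ∷ w)) → T (nondeg (a ∷ b ∷ w))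
  nondeg-∷ {a = a} {b} w a≢b nd with a ≟ b
  ... | yes a≡b = contradiction a≡b a≢b
  ... | no  _   = nd

  nondeg-alternating : ∀ {a b} → a ≢ b → ∀ L → T (nondeg (alternating a b L))
  nondeg-alternating         a≢b zero          = _
  nondeg-alternating         a≢b (suc zero)    = _
  nondeg-alternating {a} {b} a≢b (suc (suc L)) =
    nondeg-∷ (alternating a b L) a≢b (nondeg-alternating (≢-sym a≢b) (suc L))

  allowed-∷⁻ : ∀ {L} a b (r : Vec (Fin k) L) → T (allowed (a ∷ b ∷ r)) → T (E a b) × T (allowed (b ∷ r))
  allowed-∷⁻ a b r = Equivalence.to T-∧

  allowed-∷ : ∀ {m} x (u : Vec (Fin k) m) → ¬ T (allowed u) → ¬ T (allowed (x ∷ u))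
  allowed-∷ x []      u∉ _  = u∉ _
  allowed-∷ x (y ∷ r) u∉ xu = u∉ (proj₂ (allowed-∷⁻ x y r xu))

  allowed⇒nondeg : ∀ {m} (u : Vec (Fin k) m) → T (allowed u) → T (nondeg u)
  allowed⇒nondeg []          _  = _
  allowed⇒nondeg (_ ∷ [])    _  = _
  allowed⇒nondeg (a ∷ b ∷ r) al =
    nondeg-∷ r (edge⇒≢ (proj₁ ab)) (allowed⇒nondeg (b ∷ r) (proj₂ ab))
    where ab = allowed-∷⁻ a b r al

  allowed-alternating : ∀ a b L → allowed (alternating a b (suc (suc L))) ≡ E a b
  allowed-alternating a b zero    = ∧-identityʳ (E a b)
  allowed-alternating a b (suc L) = ≡.trans
    (≡.cong (E a b ∧_) (≡.trans (allowed-alternating b a L) (E-sym b a)))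
    (∧-idem (E a b))

  allowed-∷-alternating : ∀ {L} u v (w : Vec (Fin k) (suc L)) → isAlternating (u ∷ v ∷ w) ≡ true →
                          allowed (u ∷ v ∷ w) ≡ allowed (v ∷ w)
  allowed-∷-alternating {L} u v w alt = begin
    allowed (u ∷ v ∷ w)                              ≡⟨ ≡.cong allowed u∷v∷w≡ ⟩
    allowed (alternating u v (suc (suc (suc L))))    ≡⟨ allowed-alternating u v (suc L) ⟩
    E u v                                            ≡⟨ E-sym u v ⟩
    E v u                                            ≡⟨ allowed-alternating v u L ⟨
    allowed (alternating v u (suc (suc L)))          ≡⟨ ≡.cong (allowed ∘ tail) u∷v∷w≡ ⟨
    allowed (v ∷ w)                                  ∎
    where u∷v∷w≡ = isAlternating⇒alternating u v w alt

module _ {c ℓ : Level} (R : CommutativeRing c ℓ) (G : Graph) where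
  open CommutativeRing R renaming (refl to ≈-refl)
  open RingProperties ring using (-‿distribˡ-*; -‿distribʳ-*; -‿involutive; -‿injective; -0#≈0#;
                                  +-inverseˡ-unique; x∙y⁻¹≈ε⇒x≈y)
  open CommutativeMonoidSum +-commutativeMonoid using (sum; sum-cong-≋)
  open CommutativeMonoidSumProperties +-commutativeMonoid using (sum-zero; sum-single)
  open AbelianGroupSumProperties +-abelianGroup using (sum-⁻¹)
  open import Relation.Binary.Reasoning.Setoid setoid
  open Graph G
  open GraphProperties G
  open PathHomology R G
  open AllowedTuples R G

  sign² : ∀ i → sign i * sign i ≈ 1#
  sign² zero    = *-identityˡ 1#
  sign² (suc i) = begin
    - sign i * - sign i      ≈⟨ -‿distribˡ-* _ _ ⟨
    - (sign i * - sign i)    ≈⟨ -‿cong (-‿distribʳ-* _ _) ⟨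
    - - (sign i * sign i)    ≈⟨ -‿involutive _ ⟩
    sign i * sign i          ≈⟨ sign² i ⟩
    1#                       ∎

  -s*v≈u : ∀ {s u v} → s * s ≈ 1# → v + s * u ≈ 0# → - s * v ≈ u
  -s*v≈u {s} {u} {v} s²≈1 v+su≈0 = begin
    - s * v              ≈⟨ *-congˡ (+-inverseˡ-unique v (s * u) v+su≈0) ⟩
    - s * - (s * u)      ≈⟨ -‿distribˡ-* _ _ ⟨
    - (s * - (s * u))    ≈⟨ -‿cong (-‿distribʳ-* _ _) ⟨
    - - (s * (s * u))    ≈⟨ -‿involutive _ ⟩
    s * (s * u)          ≈⟨ *-assoc s s u ⟨
    s * s * u            ≈⟨ *-congʳ s²≈1 ⟩
    1# * u               ≈⟨ *-identityˡ u ⟩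
    u                    ∎

  if-≈0 : ∀ b {v} → v ≈ 0# → (if b then v else 0#) ≈ 0#
  if-≈0 true  v≈0 = v≈0
  if-≈0 false _   = ≈-refl

  nondegPart : ∀ {n} → Chain n → Chain n
  nondegPart x t = if nondeg t then x t else 0#

  nondegPart-nondeg : ∀ {n} (x : Chain n) t → T (nondeg t) → nondegPart x t ≡ x t
  nondegPart-nondeg x t nd = ≡.cong (λ b → if b then x t else 0#) (Equivalence.to T-≡ nd)

  nondegPart-allowed : ∀ {n} {x : Chain n} → InAllowed x → ∀ t → ¬ T (allowed t) → nondegPart x t ≈ 0#
  nondegPart-allowed {x = x} x-allowed t t∉ with nondeg t in nd
  ... | true  = x-allowed t (Equivalence.from T-≡ nd) t∉
  ... | false = ≈-refl

  -- The boundary formula applied to an arbitrary function on tuples; ∂ x is  ∂free (nondegPart x)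
  -- by definition.
  ∂free : ∀ {L} → (Vec (Fin k) (suc L) → Carrier) → Vec (Fin k) L → Carrier
  ∂free {L} φ w = sum (λ (i : Fin (suc L)) → sign (toℕ i) * sum (λ v → φ (insertAt w i v)))

  ∂free-zero : ∀ {L} (φ : Vec (Fin k) (suc L) → Carrier) w → (∀ t → φ t ≈ 0#) → ∂free φ w ≈ 0#
  ∂free-zero φ w φ≈0 = sum-zero {f = λ i → sign (toℕ i) * S i}
                                (λ i → trans (*-congˡ (sum-zero (λ v → φ≈0 (insertAt w i v)))) (zeroʳ _))
    where S = λ i → sum (λ v → φ (insertAt w i v))

  ∂free-∷ : ∀ {L} (φ : Vec (Fin k) (suc (suc L)) → Carrier) a w →
            ∂free φ (a ∷ w) ≈ sum (λ v → φ (v ∷ a ∷ w)) - ∂free (λ t → φ (a ∷ t)) w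
  ∂free-∷ φ a w = +-cong (*-identityˡ _) (begin
    sum (λ i → - sign (toℕ i) * S i)      ≈⟨ sum-cong-≋ (λ i → -‿distribˡ-* (sign (toℕ i)) (S i)) ⟨
    sum (λ i → - (sign (toℕ i) * S i))    ≈⟨ sum-⁻¹ (λ i → sign (toℕ i) * S i) ⟩
    - ∂free (λ t → φ (a ∷ t)) w           ∎)
    where S = λ i → sum (λ v → φ (a ∷ insertAt w i v))

  ∂free-∷₀ : ∀ {L} (φ : Vec (Fin k) (suc (suc L)) → Carrier) a w → (∀ v → φ (v ∷ a ∷ w) ≈ 0#) →
             ∂free φ (a ∷ w) ≈ - ∂free (λ t → φ (a ∷ t)) w
  ∂free-∷₀ φ a w φ≈0 = trans (∂free-∷ φ a w) (trans (+-congʳ (sum-zero φ≈0)) (+-identityˡ _))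

  ∂free-∷-vanishes : ∀ {L} (φ : Vec (Fin k) (suc (suc L)) → Carrier) a w → (∀ v → φ (v ∷ a ∷ w) ≈ 0#) →
                     ∂free φ (a ∷ w) ≈ 0# → ∂free (λ t → φ (a ∷ t)) w ≈ 0#
  ∂free-∷-vanishes φ a w φ≈0 ∂φ≈0 = -‿injective (begin
    - ∂free (λ t → φ (a ∷ t)) w   ≈⟨ ∂free-∷₀ φ a w φ≈0 ⟨
    ∂free φ (a ∷ w)               ≈⟨ ∂φ≈0 ⟩
    0#                            ≈⟨ -0#≈0# ⟨
    - 0#                          ∎)

  ∂free-alternating-extension : ∀ {L} a b (w : Vec (Fin k) L) (χ : Vec (Fin k) (suc L) → Carrier) →
    T (nondeg (b ∷ w)) → (∀ t → isAlternating (a ∷ b ∷ t) ≡ false → χ t ≈ 0#) →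
    ∂free χ w ≈ sign L * χ (w ∷ʳ secondLast a b w)
  ∂free-alternating-extension a b [] χ _ χ≈0 = trans (+-identityʳ _)
    (*-congˡ (sum-single a (λ v v≢a → χ≈0 (v ∷ []) (isAlternating-≢ b [] (≢-sym v≢a)))))
  ∂free-alternating-extension {suc L} a b (c ∷ w) χ nd χ≈0 = begin
    ∂free χ (c ∷ w)
      ≈⟨ ∂free-∷₀ χ c w χ≈0′ ⟩
    - ∂free (λ t → χ (c ∷ t)) w
      ≈⟨ -‿cong (∂free-alternating-extension b c w _ nd′ χc≈0) ⟩
    - (sign L * χ (c ∷ (w ∷ʳ secondLast b c w)))
      ≈⟨ -‿distribˡ-* _ _ ⟩
    - sign L * χ (c ∷ (w ∷ʳ secondLast b c w))
      ∎
    where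
      b≢c = proj₁ (nondeg-∷⁻ b c w nd)
      nd′ = proj₂ (nondeg-∷⁻ b c w nd)
      χ≈0′ : ∀ v → χ (v ∷ c ∷ w) ≈ 0#
      χ≈0′ v = χ≈0 (v ∷ c ∷ w) (isAlternating-∷ a (b ∷ v ∷ c ∷ w) (isAlternating-≢ v w b≢c))
      χc≈0 : ∀ t → isAlternating (b ∷ c ∷ t) ≡ false → χ (c ∷ t) ≈ 0#
      χc≈0 t alt = χ≈0 (c ∷ t) (isAlternating-∷ a (b ∷ c ∷ t) alt)

  ∂free-alternating : ∀ {L} (ψ : Vec (Fin k) (suc (suc (suc L))) → Carrier) →
    (∀ t → isAlternating t ≡ false → ψ t ≈ 0#) →
    ∀ {a b} (w : Vec (Fin k) L) → a ≢ b → T (nondeg (b ∷ w)) →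
    ∂free ψ (a ∷ b ∷ w) ≈ ψ (b ∷ a ∷ b ∷ w) + sign L * ψ (a ∷ b ∷ (w ∷ʳ secondLast a b w))
  ∂free-alternating {L} ψ ψ≈0 {a} {b} w a≢b nd = begin
    ∂free ψ (a ∷ b ∷ w)                                             ≈⟨ ∂free-∷ ψ a (b ∷ w) ⟩
    sum (λ v → ψ (v ∷ a ∷ b ∷ w)) - ∂free (λ t → ψ (a ∷ t)) (b ∷ w) ≈⟨ +-cong first (-‿cong rest) ⟩
    ψ (b ∷ a ∷ b ∷ w) - - (sign L * ψ (a ∷ b ∷ (w ∷ʳ e)))           ≈⟨ +-congˡ (-‿involutive _) ⟩
    ψ (b ∷ a ∷ b ∷ w) + sign L * ψ (a ∷ b ∷ (w ∷ʳ e))               ∎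
    where
      e = secondLast a b w
      first : sum (λ v → ψ (v ∷ a ∷ b ∷ w)) ≈ ψ (b ∷ a ∷ b ∷ w)
      first = sum-single b (λ v v≢b → ψ≈0 (v ∷ a ∷ b ∷ w) (isAlternating-≢ a w v≢b))
      rest : ∂free (λ t → ψ (a ∷ t)) (b ∷ w) ≈ - (sign L * ψ (a ∷ b ∷ (w ∷ʳ e)))
      rest = trans (∂free-∷₀ (λ t → ψ (a ∷ t)) b w (λ v → ψ≈0 (a ∷ v ∷ b ∷ w) (isAlternating-≢ v w a≢b)))
                   (-‿cong (∂free-alternating-extension a b w _ nd (λ t → ψ≈0 (a ∷ b ∷ t))))

  ∂free-at-alternating : ∀ {L} (ψ : Vec (Fin k) (suc (suc (suc L))) → Carrier) →
    (∀ t → isAlternating t ≡ false → ψ t ≈ 0#) → ∀ {a b} → a ≢ b →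
    ∂free ψ (alternating a b (suc (suc L))) ≈
      ψ (alternating b a (suc (suc (suc L)))) + sign L * ψ (alternating a b (suc (suc (suc L))))
  ∂free-at-alternating {L} ψ ψ≈0 {a} {b} a≢b =
    trans (∂free-alternating ψ ψ≈0 (alternating a b L) a≢b (nondeg-alternating (≢-sym a≢b) (suc L)))
          (+-congˡ (*-congˡ (reflexive (≡.cong (λ t → ψ (a ∷ b ∷ t)) (alternating-∷ʳ a b L)))))

  ∂free-at-non-alternating : ∀ {L} (ψ : Vec (Fin k) (suc (suc (suc L))) → Carrier) →
    (∀ t → isAlternating t ≡ false → ψ t ≈ 0#) →
    ∀ a b (w : Vec (Fin k) L) → T (nondeg (a ∷ b ∷ w)) → isAlternating (a ∷ b ∷ w) ≡ false →
    ∂free ψ (a ∷ b ∷ w) ≈ 0#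
  ∂free-at-non-alternating {L} ψ ψ≈0 a b w nd nalt = begin
    ∂free ψ (a ∷ b ∷ w)
      ≈⟨ ∂free-alternating ψ ψ≈0 w a≢b nd′ ⟩
    ψ (b ∷ a ∷ b ∷ w) + sign L * ψ (a ∷ b ∷ (w ∷ʳ e))
      ≈⟨ +-cong (ψ≈0 _ (isAlternating-∷ b (a ∷ b ∷ w) nalt))
                (*-congˡ (ψ≈0 _ (isAlternating-∷ʳ (a ∷ b ∷ w) e nalt))) ⟩
    0# + sign L * 0#
      ≈⟨ trans (+-identityˡ _) (zeroʳ _) ⟩
    0#
      ∎
    where
      e = secondLast a b w
      a≢b = proj₁ (nondeg-∷⁻ a b w nd)
      nd′ = proj₂ (nondeg-∷⁻ a b w nd)

  bridged-not-allowed : ∀ {L} {w : Vec (Fin k) (suc L)} {f} → Bridged w f → ¬ T (allowed w)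
  bridged-not-allowed (here {a = a} {b = b} {r = r} ab∉E _) = ab∉E ∘ proj₁ ∘ allowed-∷⁻ a b r
  bridged-not-allowed (there a {w} g)                       = allowed-∷ a w (bridged-not-allowed g)

  ∂free-bridged : ∀ {L} (φ : Vec (Fin k) (suc (suc L)) → Carrier) → (∀ t → ¬ T (allowed t) → φ t ≈ 0#) →
                  ∀ {w f} → Bridged w f → ∂free φ w ≈ 0# → φ f ≈ 0#
  ∂free-bridged φ φ≈0 g@(here {a = a} {m} {b} {r} ab∉E unique) ∂φ≈0 = begin
    φ (a ∷ m ∷ b ∷ r)
      ≈⟨ sum-single m (λ v v≢m → φ≈0 _ (v≢m ∘ through-m v)) ⟨
    sum (λ v → φ (a ∷ v ∷ b ∷ r))
      ≈⟨ x∙y⁻¹≈ε⇒x≈y _ _ (trans (sym (∂free-∷ φa b r)) ∂φa≈0) ⟩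
    ∂free (λ t → φ (a ∷ b ∷ t)) r
      ≈⟨ ∂free-zero _ r (λ t → φ≈0 (a ∷ b ∷ t) (ab∉E ∘ proj₁ ∘ allowed-∷⁻ a b t)) ⟩
    0#
      ∎
    where
      through-m : ∀ v → T (allowed (a ∷ v ∷ b ∷ r)) → v ≡ m
      through-m v al = unique v (proj₁ avb) (proj₁ (allowed-∷⁻ v b r (proj₂ avb)))
        where avb = allowed-∷⁻ a v (b ∷ r) al
      φa = λ t → φ (a ∷ t)
      ∂φa≈0 = ∂free-∷-vanishes φ a (b ∷ r)
                (λ v → φ≈0 _ (allowed-∷ v (a ∷ b ∷ r) (bridged-not-allowed g))) ∂φ≈0
  ∂free-bridged φ φ≈0 g@(there a {w} g′) ∂φ≈0 =
    ∂free-bridged (λ t → φ (a ∷ t)) (λ t → φ≈0 (a ∷ t) ∘ allowed-∷ a t) g′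
      (∂free-∷-vanishes φ a w (λ v → φ≈0 _ (allowed-∷ v (a ∷ w) (bridged-not-allowed g))) ∂φ≈0)

  bridge : No3Cycle G → No4Cycle G → ∀ {L} a (u : Vec (Fin k) (suc (suc L))) →
           T (allowed (a ∷ u)) → isAlternating (a ∷ u) ≡ false →
           Σ (Vec (Fin k) (suc L)) λ r → Bridged (a ∷ r) (a ∷ u) × T (nondeg (a ∷ r))
  bridge no3 no4 a (c ∷ d ∷ r) al nalt with a ≟ d
  ... | no a≢d =
    d ∷ r , here (no-triangle no3 ac cd a≢d) (unique-common-neighbour no4 a≢d ac cd) ,
    nondeg-∷ r a≢d (allowed⇒nondeg (d ∷ r) (proj₂ cdr))
    where
      ac  = proj₁ (allowed-∷⁻ a c (d ∷ r) al)
      cdr = allowed-∷⁻ c d r (proj₂ (allowed-∷⁻ a c (d ∷ r) al))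
      cd  = proj₁ cdr
  bridge no3 no4 a (c ∷ d ∷ [])    al ()   | yes _
  bridge no3 no4 a (c ∷ d ∷ e ∷ r) al nalt | yes _
    with bridge no3 no4 c (d ∷ e ∷ r) (proj₂ (allowed-∷⁻ a c (d ∷ e ∷ r) al)) nalt
  ... | r′ , g , nd = c ∷ r′ , there a g , nondeg-∷ r′ (edge⇒≢ (proj₁ (allowed-∷⁻ a c (d ∷ e ∷ r) al))) nd

  alternating-support : No3Cycle G → No4Cycle G → ∀ {n} (x : Chain (suc (suc n))) →
                        InAllowed x → InAllowed (∂ x) →
                        ∀ t → isAlternating t ≡ false → nondegPart x t ≈ 0#
  alternating-support no3 no4 x x-allowed ∂x-allowed (a ∷ u) nalt with T? (allowed (a ∷ u))
  ... | no  t∉ = nondegPart-allowed x-allowed (a ∷ u) t∉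
  ... | yes al with bridge no3 no4 a u al nalt
  ...   | r , g , nd = ∂free-bridged (nondegPart x) (nondegPart-allowed x-allowed) g
                         (∂x-allowed (a ∷ r) nd (bridged-not-allowed g))

  module Filling {n} (x : Chain (suc (suc n))) (x-allowed : InAllowed x)
                 (x-support : ∀ t → isAlternating t ≡ false → nondegPart x t ≈ 0#)
                 (x-cycle : ∂ x ≈C zeroC) where

    N : ℕ
    N = suc (suc (suc n))

    y : Chain (suc (suc (suc n)))
    y (u ∷ w) = if isAlternating (u ∷ w) ∧ does (head w <? u) then x w else 0#

    y-support : ∀ t → isAlternating t ≡ false → nondegPart y t ≈ 0#
    y-support (u ∷ w) nalt = if-≈0 (nondeg (u ∷ w))
      (reflexive (≡.cong (λ b → if b ∧ does (head w <? u) then x w else 0#) nalt))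

    y-on-alternating : ∀ {a b} → a ≢ b →
      nondegPart y (alternating a b (suc N)) ≡ (if does (b <? a) then x (alternating b a N) else 0#)
    y-on-alternating {a} {b} a≢b = ≡.trans
      (nondegPart-nondeg y (alternating a b (suc N)) (nondeg-alternating a≢b (suc N)))
      (≡.cong (λ c → if c ∧ does (b <? a) then x (alternating b a N) else 0#)
              (isAlternating-alternating a b (suc N)))

    cycle-relation : ∀ {a b} → a ≢ b → x (alternating b a N) + sign n * x (alternating a b N) ≈ 0#
    cycle-relation {a} {b} a≢b = begin
      x (alternating b a N) + sign n * x (alternating a b N)
        ≡⟨ ≡.cong₂ (λ p q → p + sign n * q)
                   (nondegPart-nondeg x (alternating b a N) (nondeg-alternating (≢-sym a≢b) N))
                   (nondegPart-nondeg x (alternating a b N) (nondeg-alternating a≢b N)) ⟨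
      nondegPart x (alternating b a N) + sign n * nondegPart x (alternating a b N)
        ≈⟨ ∂free-at-alternating (nondegPart x) x-support a≢b ⟨
      ∂ x (alternating a b (suc (suc n)))
        ≈⟨ x-cycle _ (nondeg-alternating a≢b (suc (suc n))) ⟩
      0# ∎

    ∂y-on-alternating : ∀ {a b} → a ≢ b → ∂ y (alternating a b N) ≈
      (if does (a <? b) then x (alternating a b N) else 0#) +
      sign (suc n) * (if does (b <? a) then x (alternating b a N) else 0#)
    ∂y-on-alternating {a} {b} a≢b = trans (∂free-at-alternating (nondegPart y) y-support a≢b)
      (reflexive (≡.cong₂ (λ p q → p + sign (suc n) * q) (y-on-alternating {b} {a} (≢-sym a≢b))
                                                          (y-on-alternating {a} {b} a≢b)))

    ∂y≈x-on-alternating : ∀ {a b} → a ≢ b → ∂ y (alternating a b N) ≈ x (alternating a b N)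
    ∂y≈x-on-alternating {a} {b} a≢b = trans (∂y-on-alternating a≢b) (by-order (a <? b) (b <? a))
      where
        X  = x (alternating a b N)
        X′ = x (alternating b a N)
        by-order : (a<?b : Dec (a < b)) (b<?a : Dec (b < a)) →
                   (if does a<?b then X else 0#) + sign (suc n) * (if does b<?a then X′ else 0#) ≈ X
        by-order (yes _)   (no _)    = trans (+-congˡ (zeroʳ _)) (+-identityʳ X)
        by-order (no _)    (yes _)   = trans (+-identityˡ _) (-s*v≈u (sign² n) (cycle-relation a≢b))
        by-order (yes a<b) (yes b<a) = contradiction b<a (<-asym a<b)
        by-order (no a≮b)  (no b≮a)  with <-cmp a b
        ... | tri< a<b _   _   = contradiction a<b a≮b
        ... | tri≈ _   a≡b _   = contradiction a≡b a≢b
        ... | tri> _   _   b<a = contradiction b<a b≮a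

    ∂y≈x : ∂ y ≈C x
    ∂y≈x (a ∷ b ∷ w) nd = by-alternation (isAlternating (a ∷ b ∷ w)) ≡.refl
      where
        by-alternation : ∀ alt? → isAlternating (a ∷ b ∷ w) ≡ alt? → ∂ y (a ∷ b ∷ w) ≈ x (a ∷ b ∷ w)
        by-alternation true  alt =
          ≡.subst (λ t → ∂ y t ≈ x t) (≡.sym (isAlternating⇒alternating a b w alt))
                  (∂y≈x-on-alternating (proj₁ (nondeg-∷⁻ a b w nd)))
        by-alternation false alt = begin
          ∂ y (a ∷ b ∷ w)           ≈⟨ ∂free-at-non-alternating (nondegPart y) y-support a b w nd alt ⟩
          0#                        ≈⟨ x-support (a ∷ b ∷ w) alt ⟨
          nondegPart x (a ∷ b ∷ w)  ≡⟨ nondegPart-nondeg x (a ∷ b ∷ w) nd ⟩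
          x (a ∷ b ∷ w)             ∎

    y-allowed : InAllowed y
    y-allowed (u ∷ v ∷ w) nd uvw∉ with isAlternating (u ∷ v ∷ w) in alt
    ... | false = ≈-refl
    ... | true  = if-≈0 (does (v <? u)) (x-allowed (v ∷ w) (proj₂ (nondeg-∷⁻ u v w nd)) vw∉)
      where vw∉ = uvw∉ ∘ ≡.subst T (≡.sym (allowed-∷-alternating u v w alt))

    ∂y-allowed : InAllowed (∂ y)
    ∂y-allowed w nd w∉ = trans (∂y≈x w nd) (x-allowed w nd w∉)

proposition7p2 : ∀ {c ℓ : Level} (R : CommutativeRing c ℓ) (G : Graph) →
    No3Cycle G → No4Cycle G →
    ∀ (n : ℕ) → 2 ≤ suc n → PathHomology.HomologyVanishes R G n
proposition7p2 R G no3 no4 (suc n) (s≤s (s≤s z≤n)) x (x-allowed , ∂x-allowed) ∂x≈0 =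
  y , (y-allowed , ∂y-allowed) , ∂y≈x
  where open Filling R G x x-allowed (alternating-support R G no3 no4 x x-allowed ∂x-allowed) ∂x≈0
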